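{- Let $K$ be a commutative ring with unity and $u,v,w\in A^*$. (i) $w$ does not lie in the support of $\mathcal{L}_K(A)$ if and only if $l^*(w)=0$. (ii) The pair $(u,v)$ is twin (respectively anti-twin) with respect to $\mathcal{L}_K(A)$ if and only if $l^*(u-v)=0$ (respectively $l^*(u+v)=0$).
   Context: $A$ is a finite alphabet, $K\langle A\rangle$ the free associative algebra over $K$, $(P,w)$ the coefficient of word $w$ in $P$, scalar product $(P,Q)=\sum_w(P,w)(Q,w)$. $\mathcal{L}_K(A)$ is the Lie subalgebra (bracket $[P,Q]=PQ-QP$) generated by $A$. Support: words $w$ with $(P,w)\ne0$ for some $P\in\mathcal{L}_K(A)$. Twin (resp. anti-twin): $(Q,u)=(Q,v)$ (resp. $(Q,u)=-(Q,v)$) for all $Q\in\mathcal{L}_K(A)$. The left normed bracketing: $l(\epsilon)=0$, $l(a)=a$, $l(ua)=[l(u),a]$, extended linearly; $l^*$ is the $K$-linear endomorphism with $(l^*(u),v)=(l(v),u)$ for all words $u,v$. -}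

module Defs where

open import Level using (Level; _⊔_)
open import Data.Nat using (ℕ)
open import Data.Fin using (Fin)
open import Data.Fin.Properties using (_≟_)
open import Data.List using (List; []; _∷_)
open import Data.Product using (∃; _×_)
open import Relation.Nullary using (¬_; yes; no)
open import Algebra.Bundles using (CommutativeRing)

Word : ℕ → Set
Word n = List (Fin n)

module Free {c ℓ : Level} (K : CommutativeRing c ℓ) (n : ℕ) where
  open CommutativeRing K

  -- An element P is represented by its coefficient map w ↦ (P , w).
  Coeffs : Set c
  Coeffs = Word n → Carrier

  zeroC : Coeffs
  zeroC _ = 0#

  letter : Fin n → Coeffs
  letter a (b ∷ []) with a ≟ b
  ... | yes _ = 1#
  ... | no  _ = 0#
  letter a _ = 0#

  addC : Coeffs → Coeffs → Coeffs
  addC P Q w = P w + Q w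

  subC : Coeffs → Coeffs → Coeffs
  subC P Q w = P w - Q w

  scaleC : Carrier → Coeffs → Coeffs
  scaleC k P w = k * P w

  -- concatenation product: (PQ , w) = Σ_{w = x y} (P , x) (Q , y)
  mulC : Coeffs → Coeffs → Coeffs
  mulC P Q []      = P [] * Q []
  mulC P Q (a ∷ w) = P [] * Q (a ∷ w) + mulC (λ x → P (a ∷ x)) Q w

  bracketC : Coeffs → Coeffs → Coeffs
  bracketC P Q = subC (mulC P Q) (mulC Q P)

  -- Expressions generating the Lie subalgebra L_K(A): the smallest
  -- K-submodule containing A and closed under the bracket.
  data LieTerm : Set c where
    gen   : Fin n → LieTerm
    zer   : LieTerm
    plus  : LieTerm → LieTerm → LieTerm
    smul  : Carrier → LieTerm → LieTerm
    brack : LieTerm → LieTerm → LieTerm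

  eval : LieTerm → Coeffs
  eval (gen a)     = letter a
  eval zer         = zeroC
  eval (plus s t)  = addC (eval s) (eval t)
  eval (smul k t)  = scaleC k (eval t)
  eval (brack s t) = bracketC (eval s) (eval t)

  InLie : Coeffs → Set (c ⊔ ℓ)
  InLie Q = ∃ λ t → ∀ w → eval t w ≈ Q w

  -- left normed bracketing l : l(ε)=0, l(a)=a, l(ua)=[l(u),a]
  lnorm-from : LieTerm → Word n → LieTerm
  lnorm-from t []      = t
  lnorm-from t (a ∷ w) = lnorm-from (brack t (gen a)) w

  lnorm : Word n → LieTerm
  lnorm []      = zer
  lnorm (a ∷ w) = lnorm-from (gen a) w

  l : Word n → Coeffs
  l w = eval (lnorm w)

  lstar : Word n → Coeffs
  lstar u v = l v u

  InSupport : Word n → Set (c ⊔ ℓ)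
  InSupport w = ∃ λ Q → InLie Q × ¬ (Q w ≈ 0#)

  NotInSupport : Word n → Set (c ⊔ ℓ)
  NotInSupport w = ∀ Q → InLie Q → Q w ≈ 0#

  Twin : Word n → Word n → Set (c ⊔ ℓ)
  Twin u v = ∀ Q → InLie Q → Q u ≈ Q v

  AntiTwin : Word n → Word n → Set (c ⊔ ℓ)
  AntiTwin u v = ∀ Q → InLie Q → Q u ≈ - Q v

  IsZero : Coeffs → Set ℓ
  IsZero P = ∀ v → P v ≈ 0#

-- Every element of L_K(A) is a K-linear combination of left normed brackets l(v): the span of the
-- l(v) contains the letters and is closed under [-, a], and by the Jacobi identity
-- [P, [Q, a]] = [[P, Q], a] - [[P, a], Q] it is then closed under bracketing with every l(v),
-- hence under all brackets. Since (l*(u), v) = (l(v), u), each of the three conditions on the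
-- right says that a linear functional (P ↦ (P, w), (P, u) - (P, v) or (P, u) + (P, v)) kills
-- every l(v), which is therefore equivalent to it killing all of L_K(A).
module Submission where

open import Defs
open import Level using (Level; _⊔_)
open import Data.Nat using (ℕ)
open import Data.Fin using (Fin)
open import Data.List using ([]; _∷_; _∷ʳ_)
open import Data.Product using (_×_; _,_)
open import Function.Bundles using (_⇔_; mk⇔; Equivalence)
open import Relation.Binary.Bundles using (Setoid)
open import Relation.Binary.PropositionalEquality as ≡ using (_≡_)
open import Algebra.Bundles using (AbelianGroup; RingWithoutOne; CommutativeRing)
import Algebra.Construct.Pointwise as Pointwise
import Algebra.Properties.AbelianGroup as AbelianGroupProperties
import Algebra.Properties.RingWithoutOne as RingWithoutOneProperties
import Algebra.Properties.Ring as RingProperties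
import Algebra.Properties.CommutativeSemigroup as CommutativeSemigroupProperties
import Relation.Binary.Reasoning.Setoid as SetoidReasoning

module AbelianGroupRearrangements {a ℓ} (G : AbelianGroup a ℓ) where
  open AbelianGroup G
  open AbelianGroupProperties G using (⁻¹-∙-comm; ⁻¹-anti-homo‿-; ⁻¹-involutive)
  open CommutativeSemigroupProperties commutativeSemigroup using (interchange)
  open SetoidReasoning setoid

  [x∙y]-[u∙v]≈[x-u]∙[y-v] : ∀ x y u v → (x ∙ y) - (u ∙ v) ≈ (x - u) ∙ (y - v)
  [x∙y]-[u∙v]≈[x-u]∙[y-v] x y u v = begin
    (x ∙ y) ∙ (u ∙ v) ⁻¹     ≈⟨ ∙-congˡ (⁻¹-∙-comm u v) ⟨
    (x ∙ y) ∙ (u ⁻¹ ∙ v ⁻¹)  ≈⟨ interchange x y (u ⁻¹) (v ⁻¹) ⟩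
    (x - u) ∙ (y - v)        ∎

  [x∙y]-[u∙v]≈[x-v]-[u-y] : ∀ x y u v → (x ∙ y) - (u ∙ v) ≈ (x - v) - (u - y)
  [x∙y]-[u∙v]≈[x-v]-[u-y] x y u v = begin
    (x ∙ y) - (u ∙ v)   ≈⟨ ∙-congˡ (⁻¹-cong (comm u v)) ⟩
    (x ∙ y) - (v ∙ u)   ≈⟨ [x∙y]-[u∙v]≈[x-u]∙[y-v] x y v u ⟩
    (x - v) ∙ (y - u)   ≈⟨ ∙-congˡ (⁻¹-anti-homo‿- u y) ⟨
    (x - v) - (u - y)   ∎

  [x-y]-[u-v]≈[x-u]-[y-v] : ∀ x y u v → (x - y) - (u - v) ≈ (x - u) - (y - v)
  [x-y]-[u-v]≈[x-u]-[y-v] x y u v = begin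
    (x - y) - (u - v)           ≈⟨ [x∙y]-[u∙v]≈[x-u]∙[y-v] x (y ⁻¹) u (v ⁻¹) ⟩
    (x - u) ∙ (y ⁻¹ - v ⁻¹)     ≈⟨ ∙-congˡ (∙-congˡ (⁻¹-involutive v)) ⟩
    (x - u) ∙ (y ⁻¹ ∙ v)        ≈⟨ ∙-congˡ (comm (y ⁻¹) v) ⟩
    (x - u) ∙ (v - y)           ≈⟨ ∙-congˡ (⁻¹-anti-homo‿- y v) ⟨
    (x - u) - (y - v)           ∎

  x-z≈[x-y]∙[y-z] : ∀ x y z → x - z ≈ (x - y) ∙ (y - z)
  x-z≈[x-y]∙[y-z] x y z = begin
    x - z                 ≈⟨ ∙-congʳ (identityʳ x) ⟨
    (x ∙ ε) - z           ≈⟨ ∙-congʳ (∙-congˡ (inverseˡ y)) ⟨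
    (x ∙ (y ⁻¹ ∙ y)) - z  ≈⟨ ∙-congʳ (assoc x (y ⁻¹) y) ⟨
    ((x - y) ∙ y) - z     ≈⟨ assoc (x - y) y (z ⁻¹) ⟩
    (x - y) ∙ (y - z)     ∎

module Commutator {r ℓ} (R : RingWithoutOne r ℓ) where
  open RingWithoutOne R
  open RingWithoutOneProperties R using (x[y-z]≈xy-xz; [y-z]x≈yx-zx)
  open AbelianGroupProperties +-abelianGroup using (//-cong₂)
  open AbelianGroupRearrangements +-abelianGroup
  open SetoidReasoning setoid

  [_,_] : Carrier → Carrier → Carrier
  [ x , y ] = x * y - y * x

  [,]-cong : ∀ {x x′ y y′} → x ≈ x′ → y ≈ y′ → [ x , y ] ≈ [ x′ , y′ ]
  [,]-cong x≈x′ y≈y′ = //-cong₂ (*-cong x≈x′ y≈y′) (*-cong y≈y′ x≈x′)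

  [,]-zeroˡ : ∀ x → [ 0# , x ] ≈ 0#
  [,]-zeroˡ x = trans (//-cong₂ (zeroˡ x) (zeroʳ x)) (-‿inverseʳ 0#)

  [,]-zeroʳ : ∀ x → [ x , 0# ] ≈ 0#
  [,]-zeroʳ x = trans (//-cong₂ (zeroʳ x) (zeroˡ x)) (-‿inverseʳ 0#)

  [,]-distribʳ-+ : ∀ x y z → [ x + y , z ] ≈ [ x , z ] + [ y , z ]
  [,]-distribʳ-+ x y z = begin
    (x + y) * z - z * (x + y)         ≈⟨ //-cong₂ (distribʳ z x y) (distribˡ z x y) ⟩
    (x * z + y * z) - (z * x + z * y) ≈⟨ [x∙y]-[u∙v]≈[x-u]∙[y-v] _ _ _ _ ⟩
    [ x , z ] + [ y , z ]             ∎

  [,]-distribˡ-+ : ∀ x y z → [ x , y + z ] ≈ [ x , y ] + [ x , z ]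
  [,]-distribˡ-+ x y z = begin
    x * (y + z) - (y + z) * x         ≈⟨ //-cong₂ (distribˡ x y z) (distribʳ x y z) ⟩
    (x * y + x * z) - (y * x + z * x) ≈⟨ [x∙y]-[u∙v]≈[x-u]∙[y-v] _ _ _ _ ⟩
    [ x , y ] + [ x , z ]             ∎

  [,]-distribˡ-- : ∀ x y z → [ x , y - z ] ≈ [ x , y ] - [ x , z ]
  [,]-distribˡ-- x y z = begin
    x * (y - z) - (y - z) * x         ≈⟨ //-cong₂ (x[y-z]≈xy-xz x y z) ([y-z]x≈yx-zx x y z) ⟩
    (x * y - x * z) - (y * x - z * x) ≈⟨ [x-y]-[u-v]≈[x-u]-[y-v] _ _ _ _ ⟩
    [ x , y ] - [ x , z ]             ∎

  [,]-leibniz : ∀ x y z → [ x , y * z ] ≈ [ x , y ] * z + y * [ x , z ]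
  [,]-leibniz x y z = begin
    x * (y * z) - y * z * x
      ≈⟨ //-cong₂ (sym (*-assoc x y z)) (*-assoc y z x) ⟩
    x * y * z - y * (z * x)
      ≈⟨ x-z≈[x-y]∙[y-z] _ (y * x * z) _ ⟩
    (x * y * z - y * x * z) + (y * x * z - y * (z * x))
      ≈⟨ +-congˡ (//-cong₂ (*-assoc y x z) refl) ⟩
    (x * y * z - y * x * z) + (y * (x * z) - y * (z * x))
      ≈⟨ +-cong ([y-z]x≈yx-zx z _ _) (x[y-z]≈xy-xz y _ _) ⟨
    [ x , y ] * z + y * [ x , z ]
      ∎

  [,]-jacobi : ∀ x y z → [ x , [ y , z ] ] ≈ [ [ x , y ] , z ] - [ [ x , z ] , y ]
  [,]-jacobi x y z = begin
    [ x , y * z - z * y ]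
      ≈⟨ [,]-distribˡ-- x (y * z) (z * y) ⟩
    [ x , y * z ] - [ x , z * y ]
      ≈⟨ //-cong₂ ([,]-leibniz x y z) ([,]-leibniz x z y) ⟩
    ([ x , y ] * z + y * [ x , z ]) - ([ x , z ] * y + z * [ x , y ])
      ≈⟨ [x∙y]-[u∙v]≈[x-v]-[u-y] _ _ _ _ ⟩
    [ [ x , y ] , z ] - [ [ x , z ] , y ]
      ∎

module FreeAlgebra {c ℓ : Level} (K : CommutativeRing c ℓ) (n : ℕ) where
  open Free K n
  open CommutativeRing K
  open RingProperties ring using (x[y-z]≈xy-xz)
  open CommutativeSemigroupProperties +-commutativeSemigroup using (interchange)
  open CommutativeSemigroupProperties *-commutativeSemigroup using (x∙yz≈y∙xz)
  open SetoidReasoning setoid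

  infix 4 _≐_
  _≐_ : Coeffs → Coeffs → Set ℓ
  P ≐ Q = ∀ w → P w ≈ Q w

  ≐-setoid : Setoid c ℓ
  ≐-setoid = record { isEquivalence = Pointwise.isEquivalence (Word n) isEquivalence }

  -- The left quotient a⁻¹P, so that (PQ , a w) = (P , ε)(Q , a w) + (a⁻¹P Q , w).
  _⁻¹·_ : Fin n → Coeffs → Coeffs
  (a ⁻¹· P) w = P (a ∷ w)

  mulC-cong : ∀ {P P′ Q Q′} → P ≐ P′ → Q ≐ Q′ → mulC P Q ≐ mulC P′ Q′
  mulC-cong P≐P′ Q≐Q′ []      = *-cong (P≐P′ []) (Q≐Q′ [])
  mulC-cong P≐P′ Q≐Q′ (a ∷ w) =
    +-cong (*-cong (P≐P′ []) (Q≐Q′ (a ∷ w))) (mulC-cong (λ x → P≐P′ (a ∷ x)) Q≐Q′ w)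

  mulC-distribʳ : ∀ R P Q → mulC (addC P Q) R ≐ addC (mulC P R) (mulC Q R)
  mulC-distribʳ R P Q []      = distribʳ (R []) (P []) (Q [])
  mulC-distribʳ R P Q (a ∷ w) =
    trans (+-cong (distribʳ _ _ _) (mulC-distribʳ R (a ⁻¹· P) (a ⁻¹· Q) w)) (interchange _ _ _ _)

  mulC-distribˡ : ∀ R P Q → mulC R (addC P Q) ≐ addC (mulC R P) (mulC R Q)
  mulC-distribˡ R P Q []      = distribˡ (R []) (P []) (Q [])
  mulC-distribˡ R P Q (a ∷ w) =
    trans (+-cong (distribˡ _ _ _) (mulC-distribˡ (a ⁻¹· R) P Q w)) (interchange _ _ _ _)

  mulC-scaleˡ : ∀ k P Q → mulC (scaleC k P) Q ≐ scaleC k (mulC P Q)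
  mulC-scaleˡ k P Q []      = *-assoc k (P []) (Q [])
  mulC-scaleˡ k P Q (a ∷ w) =
    trans (+-cong (*-assoc _ _ _) (mulC-scaleˡ k (a ⁻¹· P) Q w)) (sym (distribˡ _ _ _))

  mulC-scaleʳ : ∀ k P Q → mulC P (scaleC k Q) ≐ scaleC k (mulC P Q)
  mulC-scaleʳ k P Q []      = x∙yz≈y∙xz (P []) k (Q [])
  mulC-scaleʳ k P Q (a ∷ w) =
    trans (+-cong (x∙yz≈y∙xz _ _ _) (mulC-scaleʳ k (a ⁻¹· P) Q w)) (sym (distribˡ _ _ _))

  -- The first line uses that a⁻¹(PQ) = (P , ε) a⁻¹Q + (a⁻¹P) Q holds definitionally.
  mulC-assoc : ∀ P Q R → mulC (mulC P Q) R ≐ mulC P (mulC Q R)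
  mulC-assoc P Q R []      = *-assoc (P []) (Q []) (R [])
  mulC-assoc P Q R (a ∷ w) = begin
    P [] * Q [] * R (a ∷ w) + mulC (addC (scaleC (P []) (a ⁻¹· Q)) (mulC (a ⁻¹· P) Q)) R w
      ≈⟨ +-congˡ (mulC-distribʳ R _ _ w) ⟩
    P [] * Q [] * R (a ∷ w) + (mulC (scaleC (P []) (a ⁻¹· Q)) R w + mulC (mulC (a ⁻¹· P) Q) R w)
      ≈⟨ +-congˡ (+-cong (mulC-scaleˡ (P []) (a ⁻¹· Q) R w) (mulC-assoc (a ⁻¹· P) Q R w)) ⟩
    P [] * Q [] * R (a ∷ w) + (P [] * mulC (a ⁻¹· Q) R w + mulC (a ⁻¹· P) (mulC Q R) w)
      ≈⟨ +-assoc _ _ _ ⟨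
    (P [] * Q [] * R (a ∷ w) + P [] * mulC (a ⁻¹· Q) R w) + mulC (a ⁻¹· P) (mulC Q R) w
      ≈⟨ +-congʳ (trans (+-congʳ (*-assoc _ _ _)) (sym (distribˡ _ _ _))) ⟩
    P [] * (Q [] * R (a ∷ w) + mulC (a ⁻¹· Q) R w) + mulC (a ⁻¹· P) (mulC Q R) w
      ∎

  coeffRing : RingWithoutOne c ℓ
  coeffRing = record
    { _*_ = mulC
    ; isRingWithoutOne = record
      { +-isAbelianGroup = Pointwise.isAbelianGroup (Word n) +-isAbelianGroup
      ; *-cong           = mulC-cong
      ; *-assoc          = mulC-assoc
      ; distrib          = mulC-distribˡ , mulC-distribʳ
      }
    }

  bracketC-scaleˡ : ∀ k P Q → bracketC (scaleC k P) Q ≐ scaleC k (bracketC P Q)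
  bracketC-scaleˡ k P Q w =
    trans (+-cong (mulC-scaleˡ k P Q w) (-‿cong (mulC-scaleʳ k Q P w))) (sym (x[y-z]≈xy-xz k _ _))

  bracketC-scaleʳ : ∀ k P Q → bracketC P (scaleC k Q) ≐ scaleC k (bracketC P Q)
  bracketC-scaleʳ k P Q w =
    trans (+-cong (mulC-scaleʳ k P Q w) (-‿cong (mulC-scaleˡ k Q P w))) (sym (x[y-z]≈xy-xz k _ _))

module LeftNormedSpan {c ℓ : Level} (K : CommutativeRing c ℓ) (n : ℕ) where
  open Free K n
  open CommutativeRing K
  open FreeAlgebra K n
  -- The commutator of coeffRing is bracketC up to η, so these laws apply to bracketC as stated.
  open Commutator coeffRing
    using ([,]-cong; [,]-zeroˡ; [,]-zeroʳ; [,]-distribʳ-+; [,]-distribˡ-+; [,]-jacobi)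
  open RingProperties ring
    using (x[y-z]≈xy-xz; -1*x≈-x; x∙y⁻¹≈ε⇒x≈y; x≈y⇒x∙y⁻¹≈ε; +-inverseˡ-unique)
  open CommutativeSemigroupProperties +-commutativeSemigroup using (interchange)
  open AbelianGroupRearrangements +-abelianGroup using ([x∙y]-[u∙v]≈[x-u]∙[y-v])
  open Setoid ≐-setoid using () renaming (refl to ≐-refl; sym to ≐-sym)

  variable
    P Q : Coeffs

  lnorm-from-∷ʳ : ∀ t v a → lnorm-from t (v ∷ʳ a) ≡ brack (lnorm-from t v) (gen a)
  lnorm-from-∷ʳ t []      a = ≡.refl
  lnorm-from-∷ʳ t (b ∷ v) a = lnorm-from-∷ʳ (brack t (gen b)) v a

  l-∷ʳ : ∀ b v a → l (b ∷ (v ∷ʳ a)) ≐ bracketC (l (b ∷ v)) (letter a)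
  l-∷ʳ b v a w = reflexive (≡.cong (λ t → eval t w) (lnorm-from-∷ʳ (gen b) v a))

  data InSpan : Coeffs → Set (c ⊔ ℓ) where
    l∈      : ∀ v → InSpan (l v)
    +-∈     : InSpan P → InSpan Q → InSpan (addC P Q)
    scale-∈ : ∀ k → InSpan P → InSpan (scaleC k P)
    ≐-∈     : P ≐ Q → InSpan Q → InSpan P

  sub-∈ : InSpan P → InSpan Q → InSpan (subC P Q)
  sub-∈ P∈ Q∈ = +-∈ P∈ (≐-∈ (λ _ → sym (-1*x≈-x _)) (scale-∈ (- 1#) Q∈))

  BracketPreservesSpan : Coeffs → Set (c ⊔ ℓ)
  BracketPreservesSpan Q = ∀ {P} → InSpan P → InSpan (bracketC P Q)

  letter-preservesSpan : ∀ a → BracketPreservesSpan (letter a)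
  letter-preservesSpan a (l∈ [])        = ≐-∈ ([,]-zeroˡ (letter a)) (l∈ [])
  letter-preservesSpan a (l∈ (b ∷ v))   = ≐-∈ (≐-sym (l-∷ʳ b v a)) (l∈ (b ∷ (v ∷ʳ a)))
  letter-preservesSpan a (+-∈ P∈ Q∈)    =
    ≐-∈ ([,]-distribʳ-+ _ _ _) (+-∈ (letter-preservesSpan a P∈) (letter-preservesSpan a Q∈))
  letter-preservesSpan a (scale-∈ k P∈) = ≐-∈ (bracketC-scaleˡ k _ _) (scale-∈ k (letter-preservesSpan a P∈))
  letter-preservesSpan a (≐-∈ P≐Q Q∈)   = ≐-∈ ([,]-cong P≐Q ≐-refl) (letter-preservesSpan a Q∈)

  bracket-letter-preservesSpan :
    ∀ a → BracketPreservesSpan Q → BracketPreservesSpan (bracketC Q (letter a))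
  bracket-letter-preservesSpan {Q} a Q-pres {P} P∈ =
    ≐-∈ ([,]-jacobi P Q (letter a))
        (sub-∈ (letter-preservesSpan a (Q-pres P∈)) (Q-pres (letter-preservesSpan a P∈)))

  lnorm-from-preservesSpan :
    ∀ t v → BracketPreservesSpan (eval t) → BracketPreservesSpan (eval (lnorm-from t v))
  lnorm-from-preservesSpan t []      t-pres = t-pres
  lnorm-from-preservesSpan t (a ∷ v) t-pres =
    lnorm-from-preservesSpan (brack t (gen a)) v (bracket-letter-preservesSpan a t-pres)

  l-preservesSpan : ∀ v → BracketPreservesSpan (l v)
  l-preservesSpan []      {P} _ = ≐-∈ ([,]-zeroʳ P) (l∈ [])
  l-preservesSpan (a ∷ v)       = lnorm-from-preservesSpan (gen a) v (letter-preservesSpan a)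

  bracket-∈ : InSpan P → InSpan Q → InSpan (bracketC P Q)
  bracket-∈ P∈ (l∈ v)         = l-preservesSpan v P∈
  bracket-∈ P∈ (+-∈ Q∈ R∈)    = ≐-∈ ([,]-distribˡ-+ _ _ _) (+-∈ (bracket-∈ P∈ Q∈) (bracket-∈ P∈ R∈))
  bracket-∈ P∈ (scale-∈ k Q∈) = ≐-∈ (bracketC-scaleʳ k _ _) (scale-∈ k (bracket-∈ P∈ Q∈))
  bracket-∈ P∈ (≐-∈ Q≐R R∈)   = ≐-∈ ([,]-cong ≐-refl Q≐R) (bracket-∈ P∈ R∈)

  eval-∈ : ∀ t → InSpan (eval t)
  eval-∈ (gen a)     = l∈ (a ∷ [])
  eval-∈ zer         = l∈ []
  eval-∈ (plus s t)  = +-∈ (eval-∈ s) (eval-∈ t)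
  eval-∈ (smul k t)  = scale-∈ k (eval-∈ t)
  eval-∈ (brack s t) = bracket-∈ (eval-∈ s) (eval-∈ t)

  record IsLinear (φ : Coeffs → Carrier) : Set (c ⊔ ℓ) where
    field
      cong-≐     : P ≐ Q → φ P ≈ φ Q
      +-homo     : ∀ P Q → φ (addC P Q) ≈ φ P + φ Q
      scale-homo : ∀ k P → φ (scaleC k P) ≈ k * φ P

  module _ {φ : Coeffs → Carrier} (φ-linear : IsLinear φ) where
    open IsLinear φ-linear

    span-annihilated : (∀ v → φ (l v) ≈ 0#) → InSpan P → φ P ≈ 0#
    span-annihilated φl≈0 (l∈ v)         = φl≈0 v
    span-annihilated φl≈0 (+-∈ P∈ Q∈)    =
      trans (+-homo _ _)
            (trans (+-cong (span-annihilated φl≈0 P∈) (span-annihilated φl≈0 Q∈)) (+-identityˡ 0#))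
    span-annihilated φl≈0 (scale-∈ k P∈) =
      trans (scale-homo k _) (trans (*-congˡ (span-annihilated φl≈0 P∈)) (zeroʳ k))
    span-annihilated φl≈0 (≐-∈ P≐Q Q∈)   = trans (cong-≐ P≐Q) (span-annihilated φl≈0 Q∈)

    Lie-annihilated⇔l-annihilated : (∀ Q → InLie Q → φ Q ≈ 0#) ⇔ (∀ v → φ (l v) ≈ 0#)
    Lie-annihilated⇔l-annihilated = mk⇔
      (λ φLie≈0 v → φLie≈0 (l v) (lnorm v , λ _ → refl))
      (λ φl≈0 Q (t , t≐Q) → trans (sym (cong-≐ t≐Q)) (span-annihilated φl≈0 (eval-∈ t)))

  evaluation-linear : ∀ w → IsLinear (λ P → P w)
  evaluation-linear w = record
    { cong-≐ = λ P≐Q → P≐Q w ; +-homo = λ _ _ → refl ; scale-homo = λ _ _ → refl }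

  difference-linear : ∀ u v → IsLinear (λ P → P u - P v)
  difference-linear u v = record
    { cong-≐ = λ P≐Q → +-cong (P≐Q u) (-‿cong (P≐Q v))
    ; +-homo = λ _ _ → [x∙y]-[u∙v]≈[x-u]∙[y-v] _ _ _ _
    ; scale-homo = λ _ _ → sym (x[y-z]≈xy-xz _ _ _)
    }

  sum-linear : ∀ u v → IsLinear (λ P → P u + P v)
  sum-linear u v = record
    { cong-≐ = λ P≐Q → +-cong (P≐Q u) (P≐Q v)
    ; +-homo = λ _ _ → interchange _ _ _ _
    ; scale-homo = λ _ _ → sym (distribˡ _ _ _)
    }

  NotInSupport⇔lstar-zero : ∀ w → NotInSupport w ⇔ IsZero (lstar w)
  NotInSupport⇔lstar-zero w = Lie-annihilated⇔l-annihilated (evaluation-linear w)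

  Twin⇔lstar-difference-zero : ∀ u v → Twin u v ⇔ IsZero (subC (lstar u) (lstar v))
  Twin⇔lstar-difference-zero u v = mk⇔
    (λ twin → to (λ Q Q∈ → x≈y⇒x∙y⁻¹≈ε (twin Q Q∈)))
    (λ lstar≈0 Q Q∈ → x∙y⁻¹≈ε⇒x≈y _ _ (from lstar≈0 Q Q∈))
    where open Equivalence (Lie-annihilated⇔l-annihilated (difference-linear u v))

  AntiTwin⇔lstar-sum-zero : ∀ u v → AntiTwin u v ⇔ IsZero (addC (lstar u) (lstar v))
  AntiTwin⇔lstar-sum-zero u v = mk⇔
    (λ antiTwin → to (λ Q Q∈ → trans (+-congʳ (antiTwin Q Q∈)) (-‿inverseˡ _)))
    (λ lstar≈0 Q Q∈ → +-inverseˡ-unique _ _ (from lstar≈0 Q Q∈))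
    where open Equivalence (Lie-annihilated⇔l-annihilated (sum-linear u v))

lemma2p3 : ∀ {c ℓ : Level} (K : CommutativeRing c ℓ) (n : ℕ) (u v w : Word n) →
    let open Free K n in
      (NotInSupport w ⇔ IsZero (lstar w))
      × (Twin u v ⇔ IsZero (subC (lstar u) (lstar v)))
      × (AntiTwin u v ⇔ IsZero (addC (lstar u) (lstar v)))
lemma2p3 K n u v w =
  NotInSupport⇔lstar-zero w , Twin⇔lstar-difference-zero u v , AntiTwin⇔lstar-sum-zero u v
  where open LeftNormedSpan K n
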